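{- For every integer $n\geq 3$, $\gamma_{\times 2}^{r}(C_n)=\gamma_{\times 3}^{r}(C_n)=n$, and \[ \gamma^{r}(C_n)=\begin{cases} \lceil n/3\rceil+1 & \text{if } n\equiv 2 \pmod 3,\\ \lceil n/3\rceil & \text{otherwise.}\end{cases} \]
   Context: All graphs are finite, simple and undirected; $C_n$ is the cycle on $n$ vertices. For a graph $G=(V,E)$ and $x\in V$, $N(x)$ is the open neighborhood and $N[x]=N(x)\cup\{x\}$. Let $k\geq 1$ and let $G$ satisfy $\delta(G)\geq k-1$. A set $S\subseteq V$ is a $k$-tuple dominating set if $|N[x]\cap S|\geq k$ for every $x\in V$. A $k$-tuple restrained dominating set is a $k$-tuple dominating set $S$ such that every vertex of $V-S$ is adjacent to at least $k$ vertices of $V-S$; $\gamma_{\times k}^{r}(G)$ is the minimum cardinality of such a set. The restrained domination number is $\gamma^{r}(G)=\gamma_{\times 1}^{r}(G)$ (minimum size of a dominating set $S$ such that every vertex outside $S$ has a neighbor outside $S$). -}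

module Defs where

open import Data.Bool using (Bool; true; false; not; _∧_; _∨_)
open import Data.Nat using (ℕ; zero; suc; _<_; _+_; _≤_; _≥_; _/_; _%_; _≡ᵇ_; NonZero)
open import Data.Fin using (Fin; toℕ)
open import Data.Fin.Subset using (Subset; _∩_; ∣_∣; ∁; _∉_)
open import Data.Vec using (tabulate)
open import Data.Product using (Σ; _×_; _,_)
open import Relation.Binary.PropositionalEquality using (_≡_)

-- A graph on vertex set Fin n is represented by its Boolean adjacency
-- function (for the cycle below it is symmetric and irreflexive when n ≥ 3).
Adj : ℕ → Set
Adj n = Fin n → Fin n → Bool

_==_ : ∀ {n} → Fin n → Fin n → Bool
x == y = toℕ x ≡ᵇ toℕ y

N : ∀ {n} → Adj n → Fin n → Subset n
N G x = tabulate (λ y → G x y)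

N[_] : ∀ {n} → Adj n → Fin n → Subset n
N[ G ] x = tabulate (λ y → (x == y) ∨ G x y)

MinDegree≥ : ∀ {n} → Adj n → ℕ → Set
MinDegree≥ G d = ∀ x → d ≤ ∣ N G x ∣

IsKTupleDom : ∀ {n} → Adj n → ℕ → Subset n → Set
IsKTupleDom G k S = ∀ x → ∣ N[ G ] x ∩ S ∣ ≥ k

IsKTupleRestrainedDom : ∀ {n} → Adj n → ℕ → Subset n → Set
IsKTupleRestrainedDom G k S =
  IsKTupleDom G k S × (∀ x → x ∉ S → ∣ N G x ∩ ∁ S ∣ ≥ k)

IsMinCard : ∀ {n} → (Subset n → Set) → ℕ → Set
IsMinCard P m = Σ (Subset _) (λ S → P S × ∣ S ∣ ≡ m) × (∀ S → P S → m ≤ ∣ S ∣)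

KTupleRestrainedDomNumber : ∀ {n} → Adj n → ℕ → ℕ → Set
KTupleRestrainedDomNumber G k m = IsMinCard (IsKTupleRestrainedDom G k) m

RestrainedDomNumber : ∀ {n} → Adj n → ℕ → Set
RestrainedDomNumber G m = KTupleRestrainedDomNumber G 1 m

C : (n : ℕ) → .{{NonZero n}} → Adj n
C n i j = (toℕ j ≡ᵇ ((suc (toℕ i)) % n)) ∨ (toℕ i ≡ᵇ ((suc (toℕ j)) % n))

⌈_/3⌉ : ℕ → ℕ
⌈ n /3⌉ = (n + 2) / 3

≥3⇒NonZero : ∀ {n} → n ≥ 3 → NonZero n
≥3⇒NonZero {suc n} _ = _

-- Every vertex of C_n has exactly two neighbours. For k ≥ 2 a vertex outside a k-tuple
-- restrained dominating set S would need two neighbours in S and two outside, so S = V.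
-- For k = 1 a vertex outside S has exactly one neighbour outside S, so V − S is a disjoint
-- union of edges and |V − S| is even, while summing |N[x] ∩ S| ≥ 1 over all x gives
-- n ≤ 3|S|. Hence |S| ≥ ⌈n/3⌉, and |S| ≥ ⌈n/3⌉ + 1 when n ≡ 2 (mod 3) because then
-- |S| = ⌈n/3⌉ leaves |V − S| odd. The multiples of 3, together with the vertex n − 1 when
-- n ≡ 2 (mod 3), attain these bounds.
module Submission where

open import Defs
open import Data.Bool using (Bool; true; false; not; _∧_; _∨_; _xor_; T)
open import Data.Bool.Properties using (T-≡; ∧-distribˡ-∨)
open import Data.Fin using (Fin; zero; suc; toℕ; fromℕ; fromℕ<; inject₁)
open import Data.Fin.Permutation using (permutation)
open import Data.Fin.Properties using (toℕ-injective; toℕ-fromℕ<; toℕ-fromℕ; toℕ-inject₁; toℕ-inject₁-≢; toℕ<n) renaming (_≟_ to _≟ᶠ_)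
open import Data.Fin.Subset using (Subset; _∩_; ∣_∣; ∁; _∉_; _⊆_; ⊤)
open import Data.Fin.Subset.Properties using (∈⊤; p⊆q⇒∣p∣≤∣q∣; ∣⊤∣≡n; ∣∁p∣≡n∸∣p∣)
open import Data.Nat using (ℕ; zero; suc; _+_; _*_; _∸_; _≤_; _<_; _≥_; _%_; _/_; _≡ᵇ_; z≤n; s≤s; s≤s⁻¹)
open import Data.Nat.DivMod using (m*n%n≡0; [m+kn]%n≡m%n; m%n<n; n%n≡0; m<n⇒m%n≡m; m<n⇒m/n≡0; m/n≡1+[m∸n]/n)
open import Data.Nat.Properties
open import Data.Nat.Tactic.RingSolver using (solve-∀)
open import Data.Product using (∃; _×_; _,_; proj₁; proj₂)
open import Data.Vec using (_∷_; []; tabulate; lookup)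
open import Data.Vec.Properties using (lookup-map; []=⇒lookup; lookup⇒[]=; lookup-replicate; lookup∘tabulate; tabulate-cong)
open import Data.Empty using (⊥-elim)
open import Function.Base using (_∘_)
open import Function.Bundles using (Equivalence)
open import Relation.Nullary using (¬_; yes; no; contradiction)
open import Relation.Binary.PropositionalEquality

open import Algebra.Properties.CommutativeMonoid.Sum +-0-commutativeMonoid
  using (sum; sum-permute; ∑-distrib-+; sum-cong-≗; sum-replicate-zero)

⟦_⟧ : Bool → ℕ
⟦ true ⟧ = 1
⟦ false ⟧ = 0

sum-const-1 : ∀ n → sum {n} (λ _ → 1) ≡ n
sum-const-1 zero = refl
sum-const-1 (suc n) = cong suc (sum-const-1 n)

sum-mono-≤ : ∀ {n} {f g : Fin n → ℕ} → (∀ i → f i ≤ g i) → sum f ≤ sum g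
sum-mono-≤ {zero} f≤g = z≤n
sum-mono-≤ {suc n} f≤g = +-mono-≤ (f≤g zero) (sum-mono-≤ (λ i → f≤g (suc i)))

∣∷∣ : ∀ {n} b (p : Subset n) → ∣ b ∷ p ∣ ≡ ⟦ b ⟧ + ∣ p ∣
∣∷∣ true p = refl
∣∷∣ false p = refl

∣p∣≡∑ : ∀ {n} (p : Subset n) → ∣ p ∣ ≡ sum (λ i → ⟦ lookup p i ⟧)
∣p∣≡∑ [] = refl
∣p∣≡∑ (b ∷ p) = trans (∣∷∣ b p) (cong (⟦ b ⟧ +_) (∣p∣≡∑ p))

∣tabulate∩p∣≡∑ : ∀ {n} (f : Fin n → Bool) (p : Subset n) →
  ∣ tabulate f ∩ p ∣ ≡ sum (λ i → ⟦ f i ∧ lookup p i ⟧)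
∣tabulate∩p∣≡∑ f [] = refl
∣tabulate∩p∣≡∑ f (b ∷ p) =
  trans (∣∷∣ (f zero ∧ b) (tabulate (λ i → f (suc i)) ∩ p)) (cong (⟦ f zero ∧ b ⟧ +_) (∣tabulate∩p∣≡∑ (λ i → f (suc i)) p))

∣tabulate∣-snoc : ∀ n (f : ℕ → Bool) →
  ∣ tabulate {n = suc n} (λ i → f (toℕ i)) ∣ ≡ ∣ tabulate {n = n} (λ i → f (toℕ i)) ∣ + ⟦ f n ⟧
∣tabulate∣-snoc zero f = trans (∣∷∣ (f 0) []) (+-comm ⟦ f 0 ⟧ 0)
∣tabulate∣-snoc (suc n) f = begin
  ∣ f 0 ∷ middle ∣                        ≡⟨ ∣∷∣ (f 0) middle ⟩
  ⟦ f 0 ⟧ + ∣ middle ∣                   ≡⟨ cong (⟦ f 0 ⟧ +_) (∣tabulate∣-snoc n (λ i → f (suc i))) ⟩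
  ⟦ f 0 ⟧ + (∣ inner ∣ + ⟦ f (suc n) ⟧)  ≡⟨ sym (+-assoc ⟦ f 0 ⟧ _ _) ⟩
  ⟦ f 0 ⟧ + ∣ inner ∣ + ⟦ f (suc n) ⟧    ≡⟨ cong (_+ ⟦ f (suc n) ⟧) (sym (∣∷∣ (f 0) inner)) ⟩
  ∣ f 0 ∷ inner ∣ + ⟦ f (suc n) ⟧        ∎
  where
  open ≡-Reasoning
  middle : Subset (suc n)
  middle = tabulate (λ i → f (suc (toℕ i)))
  inner : Subset n
  inner = tabulate (λ i → f (suc (toℕ i)))

1+toℕ≢1+n : ∀ {n} (i : Fin n) → suc (toℕ i) ≢ suc n
1+toℕ≢1+n i eq = <-irrefl (suc-injective eq) (toℕ<n i)

lookup-false⇒∉ : ∀ {n} {p : Subset n} {i} → lookup p i ≡ false → i ∉ p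
lookup-false⇒∉ {p = p} {i} eq i∈p = contradiction (trans (sym ([]=⇒lookup i∈p)) eq) λ ()

∉⇒lookup-false : ∀ {n} {p : Subset n} {i} → i ∉ p → lookup p i ≡ false
∉⇒lookup-false {p = p} {i} i∉p with lookup p i in eq
... | true = ⊥-elim (i∉p (lookup⇒[]= i p eq))
... | false = refl

≡⇒≡ᵇ-true : ∀ {m n} → m ≡ n → (m ≡ᵇ n) ≡ true
≡⇒≡ᵇ-true {m} {n} m≡n = Equivalence.to T-≡ (≡⇒≡ᵇ m n m≡n)

≡ᵇ-comm : ∀ m n → (m ≡ᵇ n) ≡ (n ≡ᵇ m)
≡ᵇ-comm zero zero = refl
≡ᵇ-comm zero (suc n) = refl
≡ᵇ-comm (suc m) zero = refl
≡ᵇ-comm (suc m) (suc n) = ≡ᵇ-comm m n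

≢⇒≡ᵇ-false : ∀ {m n} → m ≢ n → (m ≡ᵇ n) ≡ false
≢⇒≡ᵇ-false {m} {n} m≢n with m ≡ᵇ n in eq
... | true = ⊥-elim (m≢n (≡ᵇ⇒≡ m n (Equivalence.from T-≡ eq)))
... | false = refl

==-refl : ∀ {n} (i : Fin n) → (i == i) ≡ true
==-refl i = ≡⇒≡ᵇ-true {toℕ i} refl

==-comm : ∀ {n} (i j : Fin n) → (i == j) ≡ (j == i)
==-comm i j = ≡ᵇ-comm (toℕ i) (toℕ j)

==⇒≡ : ∀ {n} {i j : Fin n} → (i == j) ≡ true → i ≡ j
==⇒≡ {i = i} {j} eq = toℕ-injective (≡ᵇ⇒≡ (toℕ i) (toℕ j) (Equivalence.from T-≡ eq))

≢⇒==-false : ∀ {n} {i j : Fin n} → i ≢ j → (i == j) ≡ false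
≢⇒==-false {i = i} {j} i≢j with i == j in eq
... | true = ⊥-elim (i≢j (==⇒≡ eq))
... | false = refl

==-disjoint : ∀ {n} {i j : Fin n} → i ≢ j → ∀ k → ((i == k) ∧ (j == k)) ≡ false
==-disjoint {i = i} {j} i≢j k with i == k in eq
... | true = ≢⇒==-false (λ j≡k → i≢j (trans (==⇒≡ eq) (sym j≡k)))
... | false = refl

∑-δ : ∀ {n} (i : Fin n) (t : Fin n → Bool) → sum (λ j → ⟦ (i == j) ∧ t j ⟧) ≡ ⟦ t i ⟧
∑-δ {suc n} zero t = trans (cong (⟦ t zero ⟧ +_) (sum-replicate-zero n)) (+-identityʳ ⟦ t zero ⟧)
∑-δ {suc n} (suc i) t = ∑-δ i (λ j → t (suc j))

⟦∨∧⟧-disjoint : ∀ a b t → (a ∧ b) ≡ false → ⟦ (a ∨ b) ∧ t ⟧ ≡ ⟦ a ∧ t ⟧ + ⟦ b ∧ t ⟧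
⟦∨∧⟧-disjoint true true t ()
⟦∨∧⟧-disjoint true false t _ = sym (+-identityʳ _)
⟦∨∧⟧-disjoint false b t _ = refl

∑-∨-disjoint : ∀ {n} (a b t : Fin n → Bool) → (∀ i → (a i ∧ b i) ≡ false) →
  sum (λ i → ⟦ (a i ∨ b i) ∧ t i ⟧) ≡ sum (λ i → ⟦ a i ∧ t i ⟧) + sum (λ i → ⟦ b i ∧ t i ⟧)
∑-∨-disjoint a b t disjoint =
  trans (sum-cong-≗ (λ i → ⟦∨∧⟧-disjoint (a i) (b i) (t i) (disjoint i)))
        (∑-distrib-+ (λ i → ⟦ a i ∧ t i ⟧) (λ i → ⟦ b i ∧ t i ⟧))

-- On a cycle a vertex outside S has two neighbours; domination puts one of them in S
-- and restraint puts one outside, so exactly one neighbour lies in S.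
locallyRestrained : (self next prev : Bool) → Bool
locallyRestrained true _ _ = true
locallyRestrained false b c = b xor c

locallyRestrained-intro : ∀ a b c → 1 ≤ ⟦ a ⟧ + (⟦ b ⟧ + ⟦ c ⟧) →
  (a ≡ false → 1 ≤ ⟦ not b ⟧ + ⟦ not c ⟧) → T (locallyRestrained a b c)
locallyRestrained-intro true b c _ _ = _
locallyRestrained-intro false true true _ restrained = contradiction (restrained refl) λ ()
locallyRestrained-intro false true false _ _ = _
locallyRestrained-intro false false true _ _ = _
locallyRestrained-intro false false false () _

locallyRestrained-resp : ∀ {a a′ b b′ c c′} → a ≡ a′ → b ≡ b′ → c ≡ c′ →
  T (locallyRestrained a′ b′ c′) → T (locallyRestrained a b c)
locallyRestrained-resp refl refl refl holds = holds

locallyRestrained⇒dominated : ∀ a b c → T (locallyRestrained a b c) → 1 ≤ ⟦ a ⟧ + (⟦ b ⟧ + ⟦ c ⟧)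
locallyRestrained⇒dominated true b c _ = s≤s z≤n
locallyRestrained⇒dominated false true c _ = s≤s z≤n
locallyRestrained⇒dominated false false true _ = s≤s z≤n

locallyRestrained⇒restrained : ∀ a b c → T (locallyRestrained a b c) →
  a ≡ false → 1 ≤ ⟦ not b ⟧ + ⟦ not c ⟧
locallyRestrained⇒restrained false true false _ _ = s≤s z≤n
locallyRestrained⇒restrained false false true _ _ = s≤s z≤n

-- The vertices outside S are matched along the edges of the cycle.
locallyRestrained⇒paired : ∀ a b c → T (locallyRestrained a b c) →
  ⟦ not a ⟧ ≡ ⟦ not a ∧ not b ⟧ + ⟦ not c ∧ not a ⟧
locallyRestrained⇒paired true b true _ = refl
locallyRestrained⇒paired true b false _ = refl
locallyRestrained⇒paired false true false _ = refl
locallyRestrained⇒paired false false true _ = refl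

2≤in⇒¬2≤out : ∀ b c → 2 ≤ ⟦ b ⟧ + ⟦ c ⟧ → ¬ (2 ≤ ⟦ not b ⟧ + ⟦ not c ⟧)
2≤in⇒¬2≤out true true _ ()
2≤in⇒¬2≤out true false (s≤s ()) _
2≤in⇒¬2≤out false true (s≤s ()) _
2≤in⇒¬2≤out false false () _

data Residue₃ : Set where
  r₀ r₁ r₂ : Residue₃

sucᵣ : Residue₃ → Residue₃
sucᵣ r₀ = r₁
sucᵣ r₁ = r₂
sucᵣ r₂ = r₀

residue : ℕ → Residue₃
residue zero = r₀
residue (suc i) = sucᵣ (residue i)

residue-*3 : ∀ p → residue (p * 3) ≡ r₀
residue-*3 zero = refl
residue-*3 (suc p) = cong (λ r → sucᵣ (sucᵣ (sucᵣ r))) (residue-*3 p)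

-- The multiples of 3, plus the last vertex n − 1 when it is ≡ 1 (mod 3): without it that
-- vertex would have both neighbours 0 and n − 2 in the set and would not be restrained.
chosen : Residue₃ → (isLast : Bool) → Bool
chosen r₀ _ = true
chosen r₁ isLast = isLast
chosen r₂ _ = false

inPattern : (n i : ℕ) → Bool
inPattern n i = chosen (residue i) (suc i ≡ᵇ n)

chosen-last-locallyRestrained : ∀ r →
  T (locallyRestrained (chosen (sucᵣ r) true) true (chosen r false))
chosen-last-locallyRestrained r₀ = _
chosen-last-locallyRestrained r₁ = _
chosen-last-locallyRestrained r₂ = _

chosen-inner-locallyRestrained : ∀ r isLast →
  T (locallyRestrained (chosen (sucᵣ r) false) (chosen (sucᵣ (sucᵣ r)) isLast) (chosen r false))
chosen-inner-locallyRestrained r₀ _ = _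
chosen-inner-locallyRestrained r₁ _ = _
chosen-inner-locallyRestrained r₂ _ = _

inPattern-≢last : ∀ {n i} → suc i ≢ n → inPattern n i ≡ chosen (residue i) false
inPattern-≢last ne = cong (chosen _) (≢⇒≡ᵇ-false ne)

inPattern-last : ∀ i → inPattern (suc i) i ≡ chosen (residue i) true
inPattern-last i = cong (chosen (residue i)) (≡⇒≡ᵇ-true {i} refl)

multipleOf3 : ℕ → Bool
multipleOf3 i = chosen (residue i) false

multiplesOf3 : (n : ℕ) → Subset n
multiplesOf3 n = tabulate (λ i → multipleOf3 (toℕ i))

∣multiplesOf3[3p]∣ : ∀ p → ∣ multiplesOf3 (p * 3) ∣ ≡ p
∣multiplesOf3[3p+1]∣ : ∀ p → ∣ multiplesOf3 (suc (p * 3)) ∣ ≡ suc p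
∣multiplesOf3[3p+2]∣ : ∀ p → ∣ multiplesOf3 (suc (suc (p * 3))) ∣ ≡ suc p

∣multiplesOf3[3p]∣ zero = refl
∣multiplesOf3[3p]∣ (suc p) = trans (∣tabulate∣-snoc (suc (suc (p * 3))) multipleOf3)
  (trans (cong₂ _+_ (∣multiplesOf3[3p+2]∣ p) (cong (λ r → ⟦ chosen (sucᵣ (sucᵣ r)) false ⟧) (residue-*3 p)))
         (+-identityʳ (suc p)))

∣multiplesOf3[3p+1]∣ p = trans (∣tabulate∣-snoc (p * 3) multipleOf3)
  (trans (cong₂ _+_ (∣multiplesOf3[3p]∣ p) (cong (λ r → ⟦ chosen r false ⟧) (residue-*3 p)))
         (+-comm p 1))

∣multiplesOf3[3p+2]∣ p = trans (∣tabulate∣-snoc (suc (p * 3)) multipleOf3)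
  (trans (cong₂ _+_ (∣multiplesOf3[3p+1]∣ p) (cong (λ r → ⟦ chosen (sucᵣ r) false ⟧) (residue-*3 p)))
         (+-identityʳ (suc p)))

module Cycle (m : ℕ) where

  next : Fin (suc m) → Fin (suc m)
  next i = fromℕ< (m%n<n (suc (toℕ i)) (suc m))

  prev : Fin (suc m) → Fin (suc m)
  prev zero = fromℕ m
  prev (suc i) = inject₁ i

  toℕ-next : ∀ i → toℕ (next i) ≡ suc (toℕ i) % suc m
  toℕ-next i = toℕ-fromℕ< (m%n<n (suc (toℕ i)) (suc m))

  next-last : ∀ i → toℕ i ≡ m → next i ≡ zero
  next-last i i≡m = toℕ-injective (trans (toℕ-next i) (trans (cong (λ k → suc k % suc m) i≡m) (n%n≡0 (suc m))))

  toℕ-next-≢last : ∀ i → toℕ i ≢ m → toℕ (next i) ≡ suc (toℕ i)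
  toℕ-next-≢last i i≢m = trans (toℕ-next i) (m<n⇒m%n≡m (s≤s (≤∧≢⇒< (s≤s⁻¹ (toℕ<n i)) i≢m)))

  next∘prev : ∀ i → next (prev i) ≡ i
  next∘prev zero = next-last (fromℕ m) (toℕ-fromℕ m)
  next∘prev (suc i) = toℕ-injective
    (trans (toℕ-next-≢last (inject₁ i) (≢-sym (toℕ-inject₁-≢ i))) (cong suc (toℕ-inject₁ i)))

  prev∘next : ∀ i → prev (next i) ≡ i
  prev∘next i with toℕ i ≟ m
  ... | yes i≡m rewrite next-last i i≡m = toℕ-injective (trans (toℕ-fromℕ m) (sym i≡m))
  ... | no i≢m = toℕ-injective (toℕ-prev (next i) (toℕ-next-≢last i i≢m))
    where
    toℕ-prev : ∀ j → toℕ j ≡ suc (toℕ i) → toℕ (prev j) ≡ toℕ i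
    toℕ-prev (suc j) eq = trans (toℕ-inject₁ j) (suc-injective eq)

  sum-∘next : ∀ (f : Fin (suc m) → ℕ) → sum (λ i → f (next i)) ≡ sum f
  sum-∘next f = sym (sum-permute f (permutation next prev next∘prev prev∘next))

  sum-∘prev : ∀ (f : Fin (suc m) → ℕ) → sum (λ i → f (prev i)) ≡ sum f
  sum-∘prev f = sym (sum-permute f (permutation prev next prev∘next next∘prev))

  ∑-closed-neighbourhood : ∀ (f : Fin (suc m) → ℕ) →
    sum (λ i → f i + (f (next i) + f (prev i))) ≡ sum f + (sum f + sum f)
  ∑-closed-neighbourhood f =
    trans (∑-distrib-+ f (λ i → f (next i) + f (prev i)))
          (cong (sum f +_) (trans (∑-distrib-+ (λ i → f (next i)) (λ i → f (prev i)))
                                  (cong₂ _+_ (sum-∘next f) (sum-∘prev f))))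

  ==-next : ∀ i j → (i == next j) ≡ (prev i == j)
  ==-next i j with j ≟ᶠ prev i
  ... | yes refl = trans (cong (i ==_) (next∘prev i)) (trans (==-refl i) (sym (==-refl (prev i))))
  ... | no j≢prev = trans (≢⇒==-false {i = i} {next j} λ i≡next → j≢prev (trans (sym (prev∘next j)) (cong prev (sym i≡next))))
                          (sym (≢⇒==-false λ prev≡j → j≢prev (sym prev≡j)))

  C≡next∨prev : ∀ i j → C (suc m) i j ≡ (next i == j) ∨ (prev i == j)
  C≡next∨prev i j = cong₂ _∨_
    (trans (cong (toℕ j ≡ᵇ_) (sym (toℕ-next i))) (==-comm j (next i)))
    (trans (cong (toℕ i ≡ᵇ_) (sym (toℕ-next j))) (==-next i j))

  LocallyRestrained : Subset (suc m) → Set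
  LocallyRestrained p = ∀ i → T (locallyRestrained (lookup p i) (lookup p (next i)) (lookup p (prev i)))

  patternSet : Subset (suc m)
  patternSet = tabulate (λ i → inPattern (suc m) (toℕ i))

  patternSet-locallyRestrained : LocallyRestrained patternSet
  patternSet-locallyRestrained i =
    locallyRestrained-resp (lookup∘tabulate w i) (lookup∘tabulate w (next i)) (lookup∘tabulate w (prev i))
      (pattern-holds i)
    where
    w : Fin (suc m) → Bool
    w i = inPattern (suc m) (toℕ i)
    below : ∀ j → w (inject₁ j) ≡ chosen (residue (toℕ j)) false
    below j = trans (cong (inPattern (suc m)) (toℕ-inject₁ j)) (inPattern-≢last (1+toℕ≢1+n j))
    pattern-holds : ∀ i → T (locallyRestrained (w i) (w (next i)) (w (prev i)))
    pattern-holds zero = _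
    pattern-holds (suc j) with suc (toℕ j) ≟ m
    ... | yes last = locallyRestrained-resp
      (cong (chosen (sucᵣ (residue (toℕ j)))) (≡⇒≡ᵇ-true last))
      (cong w (next-last (suc j) last))
      (below j)
      (chosen-last-locallyRestrained (residue (toℕ j)))
    ... | no ¬last = locallyRestrained-resp
      (inPattern-≢last (¬last ∘ suc-injective))
      (cong (inPattern (suc m)) (toℕ-next-≢last (suc j) ¬last))
      (below j)
      (chosen-inner-locallyRestrained (residue (toℕ j)) _)

  ∣patternSet∣ : ∣ patternSet ∣ ≡ ∣ multiplesOf3 m ∣ + ⟦ chosen (residue m) true ⟧
  ∣patternSet∣ = trans (∣tabulate∣-snoc m (inPattern (suc m))) (cong₂ _+_
    (cong ∣_∣ (tabulate-cong {n = m} λ i → inPattern-≢last (1+toℕ≢1+n i)))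
    (cong ⟦_⟧ (inPattern-last m)))

  module _ (2≤m : 2 ≤ m) where

    0≢m : 0 ≢ m
    0≢m 0≡m = contradiction (subst (2 ≤_) (sym 0≡m) 2≤m) λ ()

    1≢m : 1 ≢ m
    1≢m 1≡m = contradiction (subst (2 ≤_) (sym 1≡m) 2≤m) λ { (s≤s ()) }

    next≢id : ∀ i → next i ≢ i
    next≢id i eq with toℕ i ≟ m
    ... | yes i≡m = 0≢m (trans (cong toℕ (trans (sym (next-last i i≡m)) eq)) i≡m)
    ... | no i≢m = 1+n≢n (trans (sym (toℕ-next-≢last i i≢m)) (cong toℕ eq))

    prev≢id : ∀ i → prev i ≢ i
    prev≢id i eq = next≢id i (trans (sym (cong next eq)) (next∘prev i))

    next²≢id : ∀ i → next (next i) ≢ i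
    next²≢id i eq with toℕ i ≟ m
    ... | yes i≡m rewrite next-last i i≡m =
      1≢m (trans (sym (toℕ-next-≢last zero 0≢m)) (trans (cong toℕ eq) i≡m))
    ... | no i≢m with toℕ (next i) ≟ m
    ...   | yes next≡m rewrite next-last (next i) next≡m =
      1≢m (trans (cong suc (cong toℕ eq)) (trans (sym (toℕ-next-≢last i i≢m)) next≡m))
    ...   | no next≢m = n≢2+n (trans (sym (cong toℕ eq))
                           (trans (toℕ-next-≢last (next i) next≢m) (cong suc (toℕ-next-≢last i i≢m))))
      where
      n≢2+n : ∀ {n} → n ≢ suc (suc n)
      n≢2+n eq = <-irrefl eq (m<n⇒m<1+n (n<1+n _))

    next≢prev : ∀ i → next i ≢ prev i
    next≢prev i eq = next²≢id i (trans (cong next eq) (next∘prev i))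

    ∑-next∨prev : ∀ i (t : Fin (suc m) → Bool) →
      sum (λ j → ⟦ ((next i == j) ∨ (prev i == j)) ∧ t j ⟧) ≡ ⟦ t (next i) ⟧ + ⟦ t (prev i) ⟧
    ∑-next∨prev i t = trans (∑-∨-disjoint (next i ==_) (prev i ==_) t (==-disjoint (next≢prev i)))
                            (cong₂ _+_ (∑-δ (next i) t) (∑-δ (prev i) t))

    ∣N∩p∣ : ∀ (p : Subset (suc m)) i →
      ∣ N (C (suc m)) i ∩ p ∣ ≡ ⟦ lookup p (next i) ⟧ + ⟦ lookup p (prev i) ⟧
    ∣N∩p∣ p i = begin
      ∣ N (C (suc m)) i ∩ p ∣                                        ≡⟨ ∣tabulate∩p∣≡∑ (C (suc m) i) p ⟩
      sum (λ j → ⟦ C (suc m) i j ∧ lookup p j ⟧)                    ≡⟨ sum-cong-≗ (λ j → cong (λ b → ⟦ b ∧ lookup p j ⟧) (C≡next∨prev i j)) ⟩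
      sum (λ j → ⟦ ((next i == j) ∨ (prev i == j)) ∧ lookup p j ⟧) ≡⟨ ∑-next∨prev i (lookup p) ⟩
      ⟦ lookup p (next i) ⟧ + ⟦ lookup p (prev i) ⟧                  ∎
      where open ≡-Reasoning

    ∣N[]∩p∣ : ∀ (p : Subset (suc m)) i →
      ∣ N[ C (suc m) ] i ∩ p ∣ ≡ ⟦ lookup p i ⟧ + (⟦ lookup p (next i) ⟧ + ⟦ lookup p (prev i) ⟧)
    ∣N[]∩p∣ p i = begin
      ∣ N[ C (suc m) ] i ∩ p ∣
        ≡⟨ ∣tabulate∩p∣≡∑ (λ j → (i == j) ∨ C (suc m) i j) p ⟩
      sum (λ j → ⟦ ((i == j) ∨ C (suc m) i j) ∧ lookup p j ⟧)
        ≡⟨ sum-cong-≗ (λ j → cong (λ b → ⟦ ((i == j) ∨ b) ∧ lookup p j ⟧) (C≡next∨prev i j)) ⟩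
      sum (λ j → ⟦ ((i == j) ∨ ((next i == j) ∨ (prev i == j))) ∧ lookup p j ⟧)
        ≡⟨ ∑-∨-disjoint (i ==_) (λ j → (next i == j) ∨ (prev i == j)) (lookup p) disjoint ⟩
      sum (λ j → ⟦ (i == j) ∧ lookup p j ⟧) + sum (λ j → ⟦ ((next i == j) ∨ (prev i == j)) ∧ lookup p j ⟧)
        ≡⟨ cong₂ _+_ (∑-δ i (lookup p)) (∑-next∨prev i (lookup p)) ⟩
      ⟦ lookup p i ⟧ + (⟦ lookup p (next i) ⟧ + ⟦ lookup p (prev i) ⟧)
        ∎
      where
      open ≡-Reasoning
      disjoint : ∀ j → ((i == j) ∧ ((next i == j) ∨ (prev i == j))) ≡ false
      disjoint j = trans (∧-distribˡ-∨ (i == j) _ _)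
        (cong₂ _∨_ (==-disjoint (λ i≡next → next≢id i (sym i≡next)) j) (==-disjoint (λ i≡prev → prev≢id i (sym i≡prev)) j))

    ∣N∩∁p∣ : ∀ (p : Subset (suc m)) i →
      ∣ N (C (suc m)) i ∩ ∁ p ∣ ≡ ⟦ not (lookup p (next i)) ⟧ + ⟦ not (lookup p (prev i)) ⟧
    ∣N∩∁p∣ p i = trans (∣N∩p∣ (∁ p) i)
      (cong₂ _+_ (cong ⟦_⟧ (lookup-map (next i) not p)) (cong ⟦_⟧ (lookup-map (prev i) not p)))

    restrainedDom×k⇒⊤⊆ : ∀ {k} {p : Subset (suc m)} → 2 ≤ k → IsKTupleRestrainedDom (C (suc m)) k p → ⊤ ⊆ p
    restrainedDom×k⇒⊤⊆ {k} {p} 2≤k (dominating , restrained) {i} _ with lookup p i in eq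
    ... | true = lookup⇒[]= i p eq
    ... | false = contradiction (≤-trans 2≤k outside≥k) 
                    (2≤in⇒¬2≤out (lookup p (next i)) (lookup p (prev i)) (≤-trans 2≤k inside≥k))
      where
      inside≥k : k ≤ ⟦ lookup p (next i) ⟧ + ⟦ lookup p (prev i) ⟧
      inside≥k = subst (k ≤_) (trans (∣N[]∩p∣ p i) (cong (λ b → ⟦ b ⟧ + (⟦ lookup p (next i) ⟧ + ⟦ lookup p (prev i) ⟧)) eq)) (dominating i)
      outside≥k : k ≤ ⟦ not (lookup p (next i)) ⟧ + ⟦ not (lookup p (prev i)) ⟧
      outside≥k = subst (k ≤_) (∣N∩∁p∣ p i) (restrained i (lookup-false⇒∉ eq))

    ⊤-restrainedDom×k : ∀ {k} → k ≤ 3 → IsKTupleRestrainedDom (C (suc m)) k ⊤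
    ⊤-restrainedDom×k {k} k≤3 = dominating , λ i i∉⊤ → contradiction ∈⊤ i∉⊤
      where
      dominating : IsKTupleDom (C (suc m)) k ⊤
      dominating i = subst (k ≤_) (sym (trans (∣N[]∩p∣ ⊤ i) (cong₂ _+_ (cong ⟦_⟧ (lookup-replicate i true))
        (cong₂ _+_ (cong ⟦_⟧ (lookup-replicate (next i) true)) (cong ⟦_⟧ (lookup-replicate (prev i) true)))))) k≤3

    γ×k-cycle : ∀ k → 2 ≤ k → k ≤ 3 → KTupleRestrainedDomNumber (C (suc m)) k (suc m)
    γ×k-cycle k 2≤k k≤3 =
      (⊤ , ⊤-restrainedDom×k k≤3 , ∣⊤∣≡n (suc m)) ,
      λ p isDom → subst (_≤ ∣ p ∣) (∣⊤∣≡n (suc m)) (p⊆q⇒∣p∣≤∣q∣ (restrainedDom×k⇒⊤⊆ 2≤k isDom))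

    restrainedDom⇒locallyRestrained : ∀ {p} → IsKTupleRestrainedDom (C (suc m)) 1 p → LocallyRestrained p
    restrainedDom⇒locallyRestrained {p} (dominating , restrained) i =
      locallyRestrained-intro (lookup p i) (lookup p (next i)) (lookup p (prev i))
      (subst (1 ≤_) (∣N[]∩p∣ p i) (dominating i))
      (λ i∉p → subst (1 ≤_) (∣N∩∁p∣ p i) (restrained i (lookup-false⇒∉ i∉p)))

    locallyRestrained⇒restrainedDom : ∀ {p} → LocallyRestrained p → IsKTupleRestrainedDom (C (suc m)) 1 p
    locallyRestrained⇒restrainedDom {p} local =
      (λ i → subst (1 ≤_) (sym (∣N[]∩p∣ p i)) (locallyRestrained⇒dominated (lookup p i) _ _ (local i))) ,
      (λ i i∉p → subst (1 ≤_) (sym (∣N∩∁p∣ p i))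
                   (locallyRestrained⇒restrained (lookup p i) _ _ (local i) (∉⇒lookup-false i∉p)))

    restrainedDom⇒n≤∣p∣*3 : ∀ {p} → IsKTupleRestrainedDom (C (suc m)) 1 p → suc m ≤ ∣ p ∣ * 3
    restrainedDom⇒n≤∣p∣*3 {p} isDom = begin
      suc m                                                   ≡⟨ sum-const-1 (suc m) ⟨
      sum {suc m} (λ _ → 1)                                   ≤⟨ sum-mono-≤ (λ i → locallyRestrained⇒dominated (p′ i) _ _ (local i)) ⟩
      sum (λ i → ⟦ p′ i ⟧ + (⟦ p′ (next i) ⟧ + ⟦ p′ (prev i) ⟧)) ≡⟨ ∑-closed-neighbourhood (λ i → ⟦ p′ i ⟧) ⟩
      s + (s + s)                                             ≡⟨ cong (λ t → s + (s + t)) (+-identityʳ s) ⟨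
      3 * s                                                   ≡⟨ *-comm 3 s ⟩
      s * 3                                                   ≡⟨ cong (_* 3) (∣p∣≡∑ p) ⟨
      ∣ p ∣ * 3                                               ∎
      where
      open ≤-Reasoning
      local = restrainedDom⇒locallyRestrained isDom
      p′ = lookup p
      s = sum (λ i → ⟦ p′ i ⟧)

    restrainedDom⇒∣∁p∣-even : ∀ {p} → IsKTupleRestrainedDom (C (suc m)) 1 p → ∃ λ e → ∣ ∁ p ∣ ≡ 2 * e
    restrainedDom⇒∣∁p∣-even {p} isDom = sum outsideEdge , (begin
      ∣ ∁ p ∣                                                    ≡⟨ ∣p∣≡∑ (∁ p) ⟩
      sum (λ i → ⟦ lookup (∁ p) i ⟧)                             ≡⟨ sum-cong-≗ (λ i → cong ⟦_⟧ (lookup-map i not p)) ⟩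
      sum (λ i → ⟦ not (p′ i) ⟧)                                 ≡⟨ sum-cong-≗ paired ⟩
      sum (λ i → outsideEdge i + outsideEdge (prev i))           ≡⟨ ∑-distrib-+ outsideEdge (λ i → outsideEdge (prev i)) ⟩
      sum outsideEdge + sum (λ i → outsideEdge (prev i))          ≡⟨ cong (sum outsideEdge +_) (sum-∘prev outsideEdge) ⟩
      sum outsideEdge + sum outsideEdge                           ≡⟨ cong (sum outsideEdge +_) (+-identityʳ _) ⟨
      2 * sum outsideEdge                                         ∎)
      where
      open ≡-Reasoning
      p′ = lookup p
      outsideEdge : Fin (suc m) → ℕ
      outsideEdge i = ⟦ not (p′ i) ∧ not (p′ (next i)) ⟧
      paired : ∀ i → ⟦ not (p′ i) ⟧ ≡ outsideEdge i + outsideEdge (prev i)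
      paired i = trans (locallyRestrained⇒paired (p′ i) _ _ (restrainedDom⇒locallyRestrained isDom i))
                       (cong (λ j → outsideEdge i + ⟦ not (p′ (prev i)) ∧ not (p′ j) ⟧) (sym (next∘prev i)))

[q*3+r]/3≡q : ∀ q r → r < 3 → (q * 3 + r) / 3 ≡ q
[q*3+r]/3≡q zero r r<3 = m<n⇒m/n≡0 r<3
[q*3+r]/3≡q (suc q) r r<3 = trans (m/n≡1+[m∸n]/n {suc q * 3 + r} (s≤s (s≤s (s≤s z≤n)))) (cong suc ([q*3+r]/3≡q q r r<3))

⌈3q/3⌉≡q : ∀ q → ⌈ q * 3 /3⌉ ≡ q
⌈3q/3⌉≡q q = [q*3+r]/3≡q q 2 (s≤s (s≤s (s≤s z≤n)))

⌈[3q+1]/3⌉≡q+1 : ∀ q → ⌈ suc (q * 3) /3⌉ ≡ suc q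
⌈[3q+1]/3⌉≡q+1 q = trans (cong (_/ 3) (shift q)) ([q*3+r]/3≡q (suc q) 0 (s≤s z≤n))
  where
  shift : ∀ q → suc (q * 3) + 2 ≡ suc q * 3 + 0
  shift = solve-∀

⌈[3q+2]/3⌉≡q+1 : ∀ q → ⌈ suc (suc (q * 3)) /3⌉ ≡ suc q
⌈[3q+2]/3⌉≡q+1 q = trans (cong (_/ 3) (shift q)) ([q*3+r]/3≡q (suc q) 1 (s≤s (s≤s z≤n)))
  where
  shift : ∀ q → suc (suc (q * 3)) + 2 ≡ suc q * 3 + 1
  shift = solve-∀

2≤2+n : ∀ {n} → 2 ≤ suc (suc n)
2≤2+n = s≤s (s≤s z≤n)

γʳ-C[3q] : ∀ p → RestrainedDomNumber (C (suc p * 3)) (suc p)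
γʳ-C[3q] p = (patternSet , locallyRestrained⇒restrainedDom 2≤2+n patternSet-locallyRestrained , size) ,
  λ S isDom → *-cancelʳ-≤ (suc p) ∣ S ∣ 3 (restrainedDom⇒n≤∣p∣*3 2≤2+n isDom)
  where
  open Cycle (suc (suc (p * 3)))
  size : ∣ patternSet ∣ ≡ suc p
  size = trans ∣patternSet∣ (trans (cong₂ _+_ (∣multiplesOf3[3p+2]∣ p)
    (cong (λ r → ⟦ chosen (sucᵣ (sucᵣ r)) true ⟧) (residue-*3 p))) (+-identityʳ (suc p)))

γʳ-C[3q+1] : ∀ p → RestrainedDomNumber (C (suc (suc p * 3))) (suc (suc p))
γʳ-C[3q+1] p = (patternSet , locallyRestrained⇒restrainedDom 2≤2+n patternSet-locallyRestrained , size) ,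
  λ S isDom → *-cancelʳ-< 3 (suc p) ∣ S ∣ (restrainedDom⇒n≤∣p∣*3 2≤2+n isDom)
  where
  open Cycle (suc p * 3)
  size : ∣ patternSet ∣ ≡ suc (suc p)
  size = trans ∣patternSet∣ (trans (cong₂ _+_ (∣multiplesOf3[3p]∣ (suc p))
    (cong (λ r → ⟦ chosen r true ⟧) (residue-*3 (suc p)))) (+-comm (suc p) 1))

γʳ-C[3q+2] : ∀ p → RestrainedDomNumber (C (suc (suc (suc p * 3)))) (suc (suc (suc p)))
γʳ-C[3q+2] p = (patternSet , locallyRestrained⇒restrainedDom 2≤2+n patternSet-locallyRestrained , size) ,
  λ S isDom → ≤∧≢⇒< (q<∣S∣ isDom) (q+1≢∣S∣ isDom)
  where
  open Cycle (suc (suc p * 3))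
  q = suc p
  size : ∣ patternSet ∣ ≡ suc (suc q)
  size = trans ∣patternSet∣ (trans (cong₂ _+_ (∣multiplesOf3[3p+1]∣ q)
    (cong (λ r → ⟦ chosen (sucᵣ r) true ⟧) (residue-*3 q))) (+-comm (suc q) 1))
  q<∣S∣ : ∀ {S} → IsKTupleRestrainedDom (C (suc (suc (q * 3)))) 1 S → q < ∣ S ∣
  q<∣S∣ {S} isDom = *-cancelʳ-< 3 q ∣ S ∣ (≤-trans (n≤1+n _) (restrainedDom⇒n≤∣p∣*3 2≤2+n isDom))
  -- |V − S| = 3q + 2 − (q + 1) would be odd.
  q+1≢∣S∣ : ∀ {S} → IsKTupleRestrainedDom (C (suc (suc (q * 3)))) 1 S → suc q ≢ ∣ S ∣
  q+1≢∣S∣ {S} isDom q+1≡∣S∣ = even≢odd e q (begin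
    2 * e                          ≡⟨ ∣∁S∣≡2e ⟨
    ∣ ∁ S ∣                        ≡⟨ ∣∁p∣≡n∸∣p∣ S ⟩
    suc (suc (q * 3)) ∸ ∣ S ∣      ≡⟨ cong (suc (suc (q * 3)) ∸_) q+1≡∣S∣ ⟨
    suc (suc (q * 3)) ∸ suc q      ≡⟨ cong (_∸ suc q) (split q) ⟩
    suc q + suc (2 * q) ∸ suc q    ≡⟨ m+n∸m≡n (suc q) (suc (2 * q)) ⟩
    suc (2 * q)                    ∎)
    where
    open ≡-Reasoning
    e = proj₁ (restrainedDom⇒∣∁p∣-even 2≤2+n isDom)
    ∣∁S∣≡2e = proj₂ (restrainedDom⇒∣∁p∣-even 2≤2+n isDom)
    split : ∀ q → suc (suc (q * 3)) ≡ suc q + suc (2 * q)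
    split = solve-∀

data Mod3View : ℕ → Set where
  [3p]   : ∀ p → Mod3View (p * 3)
  [3p+1] : ∀ p → Mod3View (suc (p * 3))
  [3p+2] : ∀ p → Mod3View (suc (suc (p * 3)))

mod3View : ∀ k → Mod3View k
mod3View zero = [3p] 0
mod3View (suc k) with mod3View k
... | [3p] p = [3p+1] p
... | [3p+1] p = [3p+2] p
... | [3p+2] p = [3p] (suc p)

γʳ-cycle : ∀ k → let n = 3 + k in
  (n % 3 ≡ 2 → RestrainedDomNumber (C n) (⌈ n /3⌉ + 1)) × (n % 3 ≢ 2 → RestrainedDomNumber (C n) ⌈ n /3⌉)
γʳ-cycle k with mod3View k
... | [3p] p =
  (λ n%3≡2 → contradiction (trans (sym (m*n%n≡0 (suc p) 3)) n%3≡2) λ ()) ,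
  λ _ → subst (RestrainedDomNumber (C (suc p * 3))) (sym (⌈3q/3⌉≡q (suc p))) (γʳ-C[3q] p)
... | [3p+1] p =
  (λ n%3≡2 → contradiction (trans (sym ([m+kn]%n≡m%n 1 (suc p) 3)) n%3≡2) λ ()) ,
  λ _ → subst (RestrainedDomNumber (C (suc (suc p * 3)))) (sym (⌈[3q+1]/3⌉≡q+1 (suc p))) (γʳ-C[3q+1] p)
... | [3p+2] p =
  (λ _ → subst (RestrainedDomNumber (C (suc (suc (suc p * 3)))))
                (sym (trans (cong (_+ 1) (⌈[3q+2]/3⌉≡q+1 (suc p))) (+-comm (suc (suc p)) 1)))
                (γʳ-C[3q+2] p)) ,
  λ n%3≢2 → contradiction ([m+kn]%n≡m%n 2 (suc p) 3) n%3≢2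

proposition2p3 : (n : ℕ) → (n≥3 : n ≥ 3) →
    let instance _ = ≥3⇒NonZero n≥3 in
    KTupleRestrainedDomNumber (C n) 2 n
    × KTupleRestrainedDomNumber (C n) 3 n
    × (n % 3 ≡ 2 → RestrainedDomNumber (C n) (⌈ n /3⌉ + 1))
    × (n % 3 ≢ 2 → RestrainedDomNumber (C n) ⌈ n /3⌉)
proposition2p3 (suc (suc (suc k))) (s≤s (s≤s (s≤s z≤n))) =
  γ×k-cycle 2≤2+n 2 2≤2+n (s≤s (s≤s z≤n)) , γ×k-cycle 2≤2+n 3 2≤2+n ≤-refl , γʳ-cycle k
  where open Cycle (suc (suc k))
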